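{- Let $q=p^n$, $p$ prime, and let $\mathcal S$ be a mod $p$ generalized KM-arc of type $(0,m,t)_p$ in a projective plane of order $q$ with $t\neq m$. Then the number of proper $t_p$-secants of $\mathcal S$ is at most $q\sqrt q+1$.
   Context: For a point set $\mathcal S$, an $i_p$-secant ($0\le i\le p-1$) is a line meeting $\mathcal S$ in a number of points congruent to $i\pmod p$; it is proper if it meets $\mathcal S$ in at least one point. A mod $p$ generalized KM-arc of type $(0,m,t)_p$ in a projective plane of order $q=p^n$ is a proper non-empty point set $\mathcal S$ such that every point $R\in\mathcal S$ is incident with a $t_p$-secant and the other $q$ lines through $R$ are $m_p$-secants, where $0\le m,t\le p-1$. -}

module Defs where

open import Data.Nat using (ℕ; zero; suc; _+_; _≤_; _<_; NonZero)
import Data.Nat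
open import Data.Nat.DivMod using (_%_)
open import Data.Bool using (Bool; true; false; if_then_else_; _∧_)
open import Data.Fin using (Fin)
import Data.Fin as F
open import Data.Product using (Σ; _×_; ∃)
open import Relation.Binary.PropositionalEquality using (_≡_; _≢_)
open import Function using (_∘_)

count : ∀ {n} → (Fin n → Bool) → ℕ
count {zero} f = 0
count {suc n} f = (if f F.zero then 1 else 0) + count (f ∘ F.suc)

record ProjectivePlane (q : ℕ) : Set where
  field
    nPoints nLines : ℕ
    inc : Fin nPoints → Fin nLines → Bool
    join : ∀ P Q → P ≢ Q →
      Σ (Fin nLines) λ l → (inc P l ≡ true) × (inc Q l ≡ true) ×
        (∀ l' → inc P l' ≡ true → inc Q l' ≡ true → l' ≡ l)
    meet : ∀ l m → l ≢ m →
      Σ (Fin nPoints) λ P → (inc P l ≡ true) × (inc P m ≡ true) ×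
        (∀ P' → inc P' l ≡ true → inc P' m ≡ true → P' ≡ P)
    quadrangle :
      Σ (Fin nPoints) λ A → Σ (Fin nPoints) λ B → Σ (Fin nPoints) λ C → Σ (Fin nPoints) λ D →
        (A ≢ B) × (A ≢ C) × (A ≢ D) × (B ≢ C) × (B ≢ D) × (C ≢ D) ×
        (∀ l → (inc A l ∧ inc B l ∧ inc C l) ≡ false) ×
        (∀ l → (inc A l ∧ inc B l ∧ inc D l) ≡ false) ×
        (∀ l → (inc A l ∧ inc C l ∧ inc D l) ≡ false) ×
        (∀ l → (inc B l ∧ inc C l ∧ inc D l) ≡ false)
    lineSize : ∀ l → count (λ P → inc P l) ≡ suc q

module _ {q : ℕ} (Π : ProjectivePlane q) where
  open ProjectivePlane Π

  meetSize : (Fin nPoints → Bool) → Fin nLines → ℕ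
  meetSize S l = count (λ P → inc P l ∧ S P)

  Secant : (p : ℕ) .{{_ : NonZero p}} → (Fin nPoints → Bool) → ℕ → Fin nLines → Set
  Secant p S i l = meetSize S l % p ≡ i

  record IsModPGenKMArc (p : ℕ) .{{_ : NonZero p}} (m t : ℕ) (S : Fin nPoints → Bool) : Set where
    field
      m<p : Data.Nat._<_ m p
      t<p : Data.Nat._<_ t p
      nonempty : ∃ λ P → S P ≡ true
      proper : ∃ λ P → S P ≡ false
      secants : ∀ R → S R ≡ true →
        Σ (Fin nLines) λ l → (inc R l ≡ true) × Secant p S t l ×
          (∀ l' → inc R l' ≡ true → l' ≢ l → Secant p S m l')

  open import Data.Nat using (_%_ ; _<?_)
  open import Relation.Nullary.Decidable using (⌊_⌋)
  import Data.Nat.Properties as NP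

  numProperSecants : (p : ℕ) .{{_ : NonZero p}} → (Fin nPoints → Bool) → ℕ → ℕ
  numProperSecants p S t =
    count (λ l → ⌊ 0 <? meetSize S l ⌋ ∧ ⌊ meetSize S l % p NP.≟ t ⌋)

module Submission where

-- Let L be the set of the N proper t_p-secants and x(Y) the number of lines
-- of L through the point Y.  Double counting incident pairs (point, line)
-- gives Σ x = N (q + 1) and, since two lines meet in one point,
-- Σ x² = N (N + q).  Each point of S is on exactly one line of L (its
-- t_p-secant meets S; its other lines are m_p-secants), so x = 1 on S and
-- N ≤ |S|.  On the z = q² + q + 1 − |S| points outside S the first two
-- moments A, B of x satisfy A² ≤ z B by Cauchy–Schwarz, and a polynomial
-- identity turns this into (N − 1)² ≤ q³.

open import Defs
open import Data.Nat using (ℕ; zero; suc; _+_; _*_; _∸_; _^_; _≤_; _<_; z≤n; s≤s; NonZero; _%_; _<?_)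
open import Data.Nat.Properties hiding (_≟_)
import Data.Nat.Properties as ℕ
open import Data.Nat.Tactic.RingSolver using (solve-∀)
open import Algebra.Properties.CommutativeSemigroup +-commutativeSemigroup using (xy∙z≈x∙zy; xy∙z≈xz∙y)
open import Data.Nat.Primality using (Prime)
open import Data.Bool using (Bool; true; false; if_then_else_; _∧_; not)
open import Data.Bool.Properties using (∧-idem)
open import Data.Fin using (Fin)
import Data.Fin as F
open import Data.Fin.Properties using (_≟_)
open import Data.Product using (Σ; _×_; _,_; proj₁; proj₂)
open import Data.Sum using ([_,_]′)
open import Data.Empty using (⊥-elim)
open import Function using (_∘_)
open import Relation.Nullary.Decidable using (does; ⌊_⌋; yes; no)
open import Relation.Binary.PropositionalEquality
open import Algebra.Properties.Semiring.Sum +-*-semiring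
  using (sum; ∑-comm; ∑-distrib-+; *-distribˡ-sum; *-distribʳ-sum; sum-cong-≗; sum-replicate-zero)

⟦_⟧ : Bool → ℕ
⟦ b ⟧ = if b then 1 else 0

⟦∧⟧ : ∀ a b → ⟦ a ∧ b ⟧ ≡ ⟦ a ⟧ * ⟦ b ⟧
⟦∧⟧ true  b = sym (+-identityʳ ⟦ b ⟧)
⟦∧⟧ false b = refl

⟦⟧-idem : ∀ b → ⟦ b ⟧ * ⟦ b ⟧ ≡ ⟦ b ⟧
⟦⟧-idem true  = refl
⟦⟧-idem false = refl

∧-true : ∀ {a b} → a ∧ b ≡ true → a ≡ true × b ≡ true
∧-true {true} b≡true = refl , b≡true

∧-falseˡ : ∀ {a b} → a ∧ b ≡ false → b ≡ true → a ≡ false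
∧-falseˡ {false} _   _      = refl
∧-falseˡ {true}  b≡f b≡true = trans (sym b≡true) b≡f

δ : ∀ {n} → Fin n → Fin n → ℕ
δ i k = ⟦ does (i ≟ k) ⟧

δ-≢ : ∀ {n} {i k : Fin n} → i ≢ k → δ i k ≡ 0
δ-≢ {i = i} {k} i≢k with i ≟ k
... | yes i≡k = ⊥-elim (i≢k i≡k)
... | no  _   = refl

count≡sum : ∀ {n} (f : Fin n → Bool) → count f ≡ sum (⟦_⟧ ∘ f)
count≡sum {zero}  f = refl
count≡sum {suc n} f = cong (⟦ f F.zero ⟧ +_) (count≡sum (f ∘ F.suc))

sum-ones : ∀ n → sum {n} (λ _ → 1) ≡ n
sum-ones zero    = refl
sum-ones (suc n) = cong suc (sum-ones n)

count-cong : ∀ {n} {f g : Fin n → Bool} → (∀ i → f i ≡ g i) → count f ≡ count g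
count-cong {f = f} {g} f≗g =
  trans (count≡sum f) (trans (sum-cong-≗ (cong ⟦_⟧ ∘ f≗g)) (sym (count≡sum g)))

sum-δ : ∀ {n} (f : Fin n → ℕ) (k : Fin n) → sum (λ i → f i * δ i k) ≡ f k
sum-δ {suc n} f F.zero = begin
  f F.zero * 1 + sum (λ i → f (F.suc i) * 0) ≡⟨ cong₂ _+_ (*-identityʳ _) rest≡0 ⟩
  f F.zero + 0                               ≡⟨ +-identityʳ _ ⟩
  f F.zero                                   ∎
  where
  open ≡-Reasoning
  rest≡0 : sum (λ i → f (F.suc i) * 0) ≡ 0
  rest≡0 = trans (sum-cong-≗ (λ i → *-zeroʳ (f (F.suc i)))) (sum-replicate-zero n)
sum-δ {suc n} f (F.suc k) = begin
  f F.zero * 0 + sum (λ i → f (F.suc i) * δ i k) ≡⟨ cong (_+ sum (λ i → f (F.suc i) * δ i k)) (*-zeroʳ (f F.zero)) ⟩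
  sum (λ i → f (F.suc i) * δ i k)                ≡⟨ sum-δ (f ∘ F.suc) k ⟩
  f (F.suc k)                                    ∎
  where open ≡-Reasoning

count-unique : ∀ {n} (f : Fin n → Bool) (k : Fin n) →
  f k ≡ true → (∀ i → f i ≡ true → i ≡ k) → count f ≡ 1
count-unique f k fk unique = begin
  count f                      ≡⟨ count≡sum f ⟩
  sum (⟦_⟧ ∘ f)                ≡⟨ sum-cong-≗ indicator≡δ ⟩
  sum (λ i → 1 * δ i k)        ≡⟨ sum-δ (λ _ → 1) k ⟩
  1                            ∎
  where
  open ≡-Reasoning
  indicator≡δ : ∀ i → ⟦ f i ⟧ ≡ 1 * δ i k
  indicator≡δ i with i ≟ k | f i in fi
  ... | yes refl | _     = trans (cong ⟦_⟧ (sym fi)) (cong ⟦_⟧ fk)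
  ... | no  i≢k  | true  = ⊥-elim (i≢k (unique i fi))
  ... | no  _    | false = refl

count-pos : ∀ {n} (f : Fin n → Bool) (k : Fin n) → f k ≡ true → 1 ≤ count f
count-pos {suc n} f F.zero    fk rewrite fk = s≤s z≤n
count-pos {suc n} f (F.suc k) fk = ≤-trans (count-pos (f ∘ F.suc) k fk) (m≤n+m _ _)

count-compl : ∀ {n} (f : Fin n → Bool) → count f + count (not ∘ f) ≡ n
count-compl {zero}  f = refl
count-compl {suc n} f with f F.zero
... | true  = cong suc (count-compl (f ∘ F.suc))
... | false = trans (+-suc _ _) (cong suc (count-compl (f ∘ F.suc)))

sum-mono : ∀ {n} {f g : Fin n → ℕ} → (∀ i → f i ≤ g i) → sum f ≤ sum g
sum-mono {zero}  f≤g = z≤n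
sum-mono {suc n} f≤g = +-mono-≤ (f≤g F.zero) (sum-mono (f≤g ∘ F.suc))

sum-split : ∀ {n} (P : Fin n → Bool) (f : Fin n → ℕ) →
  sum f ≡ sum (λ i → ⟦ not (P i) ⟧ * f i) + sum (λ i → ⟦ P i ⟧ * f i)
sum-split P f = trans (sum-cong-≗ split) (∑-distrib-+ (λ i → ⟦ not (P i) ⟧ * f i) (λ i → ⟦ P i ⟧ * f i))
  where
  split : ∀ i → f i ≡ ⟦ not (P i) ⟧ * f i + ⟦ P i ⟧ * f i
  split i with P i
  ... | true  = sym (+-identityʳ _)
  ... | false = sym (trans (+-identityʳ (f i + 0)) (+-identityʳ (f i)))

-- AM–GM for two naturals: 2xy ≤ x² + y², since for x ≤ y = x + k the
-- difference of the two sides is k².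
2xy≤x²+y² : ∀ x y → 2 * (x * y) ≤ x * x + y * y
2xy≤x²+y² x y = [ ordered , swapped ]′ (≤-total x y)
  where
  ordered : ∀ {x y} → x ≤ y → 2 * (x * y) ≤ x * x + y * y
  ordered {x} x≤y with m≤n⇒∃[o]m+o≡n x≤y
  ... | k , refl = subst (2 * (x * (x + k)) ≤_) (expand x k) (m≤m+n _ (k * k))
    where
    expand : ∀ x k → 2 * (x * (x + k)) + k * k ≡ x * x + (x + k) * (x + k)
    expand = solve-∀
  swapped : y ≤ x → 2 * (x * y) ≤ x * x + y * y
  swapped y≤x = subst₂ _≤_ (cong (2 *_) (*-comm y x)) (+-comm (y * y) (x * x)) (ordered y≤x)

-- If S² ≤ C·T then 2aS ≤ C·a² + T for every a: multiply by C and apply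
-- AM–GM to C·a and S.
cross-term-bound : ∀ a S C T → S * S ≤ C * T → 2 * (a * S) ≤ C * (a * a) + T
cross-term-bound a zero    C       T _ = subst (_≤ C * (a * a) + T) (sym (cong (2 *_) (*-zeroʳ a))) z≤n
cross-term-bound a (suc S) zero    T ()
cross-term-bound a S       C@(suc _) T S²≤CT = *-cancelˡ-≤ C (begin
  C * (2 * (a * S))          ≡⟨ regroup a S C ⟩
  2 * ((C * a) * S)          ≤⟨ 2xy≤x²+y² (C * a) S ⟩
  (C * a) * (C * a) + S * S  ≤⟨ +-monoʳ-≤ ((C * a) * (C * a)) S²≤CT ⟩
  (C * a) * (C * a) + C * T  ≡⟨ factor a C T ⟩
  C * (C * (a * a) + T)      ∎)
  where
  open ≤-Reasoning
  regroup : ∀ a S C → C * (2 * (a * S)) ≡ 2 * ((C * a) * S)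
  regroup = solve-∀
  factor : ∀ a C T → (C * a) * (C * a) + C * T ≡ C * (C * (a * a) + T)
  factor = solve-∀

cauchy-schwarz-step : ∀ v a S C T → S * S ≤ C * T →
  (v * a + S) * (v * a + S) ≤ (v + C) * (v * (a * a) + T)
cauchy-schwarz-step v a S C T S²≤CT = begin
  (v * a + S) * (v * a + S)                              ≡⟨ expand v a S ⟩
  v * (v * (a * a)) + v * (2 * (a * S)) + S * S          ≤⟨ +-mono-≤ (+-monoʳ-≤ _ (*-monoʳ-≤ v cross)) S²≤CT ⟩
  v * (v * (a * a)) + v * (C * (a * a) + T) + C * T      ≡⟨ factor v a C T ⟩
  (v + C) * (v * (a * a) + T)                            ∎
  where
  open ≤-Reasoning
  cross : 2 * (a * S) ≤ C * (a * a) + T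
  cross = cross-term-bound a S C T S²≤CT
  expand : ∀ v a S → (v * a + S) * (v * a + S) ≡ v * (v * (a * a)) + v * (2 * (a * S)) + S * S
  expand = solve-∀
  factor : ∀ v a C T → v * (v * (a * a)) + v * (C * (a * a) + T) + C * T ≡ (v + C) * (v * (a * a) + T)
  factor = solve-∀

cauchy-schwarz : ∀ {n} (w f : Fin n → ℕ) →
  sum (λ i → w i * f i) * sum (λ i → w i * f i) ≤ sum w * sum (λ i → w i * (f i * f i))
cauchy-schwarz {zero}  w f = z≤n
cauchy-schwarz {suc n} w f =
  cauchy-schwarz-step (w F.zero) (f F.zero) _ _ _ (cauchy-schwarz (w ∘ F.suc) (f ∘ F.suc))

outside-first-moment : ∀ N d q A → A + (N + d) ≡ N * suc q → A + d ≡ N * q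
outside-first-moment N d q A A+s≡ = +-cancelʳ-≡ N _ _ (begin
  A + d + N      ≡⟨ xy∙z≈x∙zy A d N ⟩
  A + (N + d)    ≡⟨ A+s≡ ⟩
  N * suc q      ≡⟨ *-suc N q ⟩
  N + N * q      ≡⟨ +-comm N (N * q) ⟩
  N * q + N      ∎)
  where open ≡-Reasoning

moment-difference : ∀ M s q A B → let N = suc M in
  A + s ≡ N * suc q → B + s ≡ N * (N + q) → B ≡ A + N * M
moment-difference M s q A B A+s≡ B+s≡ = +-cancelʳ-≡ s _ _ (begin
  B + s              ≡⟨ B+s≡ ⟩
  N * (N + q)        ≡⟨ split-N N M q ⟩
  N * suc q + N * M  ≡⟨ cong (_+ N * M) A+s≡ ⟨
  A + s + N * M      ≡⟨ xy∙z≈xz∙y A s (N * M) ⟩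
  A + N * M + s      ∎)
  where
  open ≡-Reasoning
  N : ℕ
  N = suc M
  split-N : ∀ N M q → N * (suc M + q) ≡ N * suc q + N * M
  split-N = solve-∀

-- As polynomials the difference of the two sides is
--   (A + d − N q)(A + N q + N − Q) − (z + N + d − Q)(A + N M),
-- so the identity follows from a polynomial identity in which both
-- relations are then used to cancel the correction terms.
secant-identity : ∀ q M d A z → let N = suc M ; Q = q * q + q + 1 in
  A + d ≡ N * q → z + (N + d) ≡ Q →
  z * (A + N * M) + d * (M * M + q * q) + N * (M * M) ≡ A * A + N * (q * q * q) + d * (M * q)
secant-identity q M d A z A+d≡Nq z+N+d≡Q = +-cancelʳ-≡ correction _ _ (begin
  lhs + (Q * B + N * q * E + N * q * Q)
    ≡⟨ cong (λ u → lhs + (Q * B + u * E + N * q * Q)) (sym A+d≡Nq) ⟩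
  lhs + (Q * B + (A + d) * E + N * q * Q)
    ≡⟨ polynomial-identity q M d A z ⟩
  rhs + ((z + (N + d)) * B + N * q * E + (A + d) * Q)
    ≡⟨ cong₂ (λ u v → rhs + (u * B + N * q * E + v * Q)) z+N+d≡Q A+d≡Nq ⟩
  rhs + (Q * B + N * q * E + N * q * Q) ∎)
  where
  open ≡-Reasoning
  N Q B E lhs rhs correction : ℕ
  N = suc M
  Q = q * q + q + 1
  B = A + N * M
  E = A + N * q + N
  lhs = z * B + d * (M * M + q * q) + N * (M * M)
  rhs = A * A + N * (q * q * q) + d * (M * q)
  correction = Q * B + N * q * E + N * q * Q
  polynomial-identity : ∀ q M d A z → let N = suc M ; Q = q * q + q + 1 ; B = A + N * M ; E = A + N * q + N in
    z * B + d * (M * M + q * q) + N * (M * M) + (Q * B + (A + d) * E + N * q * Q)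
      ≡ A * A + N * (q * q * q) + d * (M * q) + ((z + (N + d)) * B + N * q * E + (A + d) * Q)
  polynomial-identity = solve-∀

-- N lines, s points of S and z
-- further points, where A and B are the first and second moments of the
-- number of the N lines through a point outside S.  The Cauchy–Schwarz
-- inequality A² ≤ z B forces (N − 1)² ≤ q³: with s = N + d and
-- X = z B + d (M² + q²), secant-identity gives
--   X + N M² = A² + N q³ + d M q ≤ X + N q³,   as M q ≤ M² + q².
secant-bound : ∀ q N s A B z →
  A + s ≡ N * suc q → B + s ≡ N * (N + q) → z + s ≡ q * q + q + 1 → N ≤ s →
  A * A ≤ z * B → (N ∸ 1) ^ 2 ≤ q ^ 3
secant-bound q zero    s A B z _ _ _ _ _ = z≤n
secant-bound q (suc M) s A B z A+s≡ B+s≡ z+s≡Q N≤s A²≤zB with m≤n⇒∃[o]m+o≡n N≤s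
... | d , refl = subst₂ _≤_ (square M) (cube q) (*-cancelˡ-≤ N (+-cancelˡ-≤ X _ _ (begin
  X + N * (M * M)
    ≡⟨ cong (λ b → z * b + d * (M * M + q * q) + N * (M * M)) (moment-difference M s q A B A+s≡ B+s≡) ⟩
  z * (A + N * M) + d * (M * M + q * q) + N * (M * M)
    ≡⟨ secant-identity q M d A z (outside-first-moment N d q A A+s≡) z+s≡Q ⟩
  A * A + N * (q * q * q) + d * (M * q)
    ≤⟨ +-mono-≤ (+-monoˡ-≤ _ A²≤zB) (*-monoʳ-≤ d Mq≤M²+q²) ⟩
  z * B + N * (q * q * q) + d * (M * M + q * q)
    ≡⟨ xy∙z≈xz∙y (z * B) _ _ ⟩
  X + N * (q * q * q) ∎)))
  where
  open ≤-Reasoning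
  N X : ℕ
  N = suc M
  X = z * B + d * (M * M + q * q)
  Mq≤M²+q² : M * q ≤ M * M + q * q
  Mq≤M²+q² = ≤-trans (m≤m+n (M * q) (M * q + 0)) (2xy≤x²+y² M q)
  square : ∀ M → M * M ≡ (suc M ∸ 1) ^ 2
  square M = cong (M *_) (sym (*-identityʳ M))
  cube : ∀ q → q * q * q ≡ q ^ 3
  cube q = trans (*-assoc q q q) (cong (λ x → q * (q * x)) (sym (*-identityʳ q)))

module Plane {q : ℕ} (Π : ProjectivePlane q) where
  open ProjectivePlane Π

  linesThrough : (Fin nLines → Bool) → Fin nPoints → ℕ
  linesThrough L Y = count (λ ℓ → inc Y ℓ ∧ L ℓ)

  double-count : ∀ (L : Fin nLines → Bool) (g : Fin nPoints → ℕ) →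
    sum (λ Y → linesThrough L Y * g Y) ≡ sum (λ ℓ → ⟦ L ℓ ⟧ * sum (λ Y → ⟦ inc Y ℓ ⟧ * g Y))
  double-count L g = begin
    sum (λ Y → linesThrough L Y * g Y)
      ≡⟨ sum-cong-≗ expand ⟩
    sum (λ Y → sum (λ ℓ → ⟦ inc Y ℓ ∧ L ℓ ⟧ * g Y))
      ≡⟨ ∑-comm (λ Y ℓ → ⟦ inc Y ℓ ∧ L ℓ ⟧ * g Y) ⟩
    sum (λ ℓ → sum (λ Y → ⟦ inc Y ℓ ∧ L ℓ ⟧ * g Y))
      ≡⟨ sum-cong-≗ (λ ℓ → sum-cong-≗ (λ Y → regroup (inc Y ℓ) (L ℓ) (g Y))) ⟩
    sum (λ ℓ → sum (λ Y → ⟦ L ℓ ⟧ * (⟦ inc Y ℓ ⟧ * g Y)))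
      ≡⟨ sum-cong-≗ (λ ℓ → sym (*-distribˡ-sum ⟦ L ℓ ⟧ (λ Y → ⟦ inc Y ℓ ⟧ * g Y))) ⟩
    sum (λ ℓ → ⟦ L ℓ ⟧ * sum (λ Y → ⟦ inc Y ℓ ⟧ * g Y)) ∎
    where
    open ≡-Reasoning
    expand : ∀ Y → linesThrough L Y * g Y ≡ sum (λ ℓ → ⟦ inc Y ℓ ∧ L ℓ ⟧ * g Y)
    expand Y = trans (cong (_* g Y) (count≡sum (λ ℓ → inc Y ℓ ∧ L ℓ)))
                     (*-distribʳ-sum (g Y) (λ ℓ → ⟦ inc Y ℓ ∧ L ℓ ⟧))
    regroup : ∀ a b x → ⟦ a ∧ b ⟧ * x ≡ ⟦ b ⟧ * (⟦ a ⟧ * x)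
    regroup a b x = begin
      ⟦ a ∧ b ⟧ * x       ≡⟨ cong (_* x) (⟦∧⟧ a b) ⟩
      ⟦ a ⟧ * ⟦ b ⟧ * x   ≡⟨ cong (_* x) (*-comm ⟦ a ⟧ ⟦ b ⟧) ⟩
      ⟦ b ⟧ * ⟦ a ⟧ * x   ≡⟨ *-assoc ⟦ b ⟧ ⟦ a ⟧ x ⟩
      ⟦ b ⟧ * (⟦ a ⟧ * x) ∎

  meet-size : ∀ ℓ ℓ' → sum (λ Y → ⟦ inc Y ℓ ⟧ * ⟦ inc Y ℓ' ⟧) ≡ 1 + q * δ ℓ ℓ'
  meet-size ℓ ℓ' with ℓ ≟ ℓ'
  ... | yes refl = begin
    sum (λ Y → ⟦ inc Y ℓ ⟧ * ⟦ inc Y ℓ ⟧) ≡⟨ sum-cong-≗ (λ Y → ⟦⟧-idem (inc Y ℓ)) ⟩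
    sum (λ Y → ⟦ inc Y ℓ ⟧)               ≡⟨ count≡sum (λ Y → inc Y ℓ) ⟨
    count (λ Y → inc Y ℓ)                 ≡⟨ lineSize ℓ ⟩
    1 + q                                 ≡⟨ cong suc (*-identityʳ q) ⟨
    1 + q * 1                             ∎
    where open ≡-Reasoning
  ... | no ℓ≢ℓ' with meet ℓ ℓ' ℓ≢ℓ'
  ...   | P , Pℓ , Pℓ' , unique = begin
    sum (λ Y → ⟦ inc Y ℓ ⟧ * ⟦ inc Y ℓ' ⟧) ≡⟨ sum-cong-≗ (λ Y → ⟦∧⟧ (inc Y ℓ) (inc Y ℓ')) ⟨
    sum (λ Y → ⟦ inc Y ℓ ∧ inc Y ℓ' ⟧)    ≡⟨ count≡sum (λ Y → inc Y ℓ ∧ inc Y ℓ') ⟨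
    count (λ Y → inc Y ℓ ∧ inc Y ℓ')      ≡⟨ count-unique _ P (cong₂ _∧_ Pℓ Pℓ') on-both ⟩
    1                                     ≡⟨ cong suc (*-zeroʳ q) ⟨
    1 + q * 0                             ∎
    where
    open ≡-Reasoning
    on-both : ∀ Y → (inc Y ℓ ∧ inc Y ℓ') ≡ true → Y ≡ P
    on-both Y Y∈ℓ∩ℓ' with ∧-true Y∈ℓ∩ℓ'
    ... | Yℓ , Yℓ' = unique Y Yℓ Yℓ'

  join-count : ∀ P Y → P ≢ Y → linesThrough (λ ℓ → inc P ℓ) Y ≡ 1
  join-count P Y P≢Y with join P Y P≢Y
  ... | ℓ , Pℓ , Yℓ , unique = count-unique _ ℓ (cong₂ _∧_ Yℓ Pℓ) on-both
    where
    on-both : ∀ ℓ' → (inc Y ℓ' ∧ inc P ℓ') ≡ true → ℓ' ≡ ℓ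
    on-both ℓ' Yℓ'∧Pℓ' with ∧-true Yℓ'∧Pℓ'
    ... | Yℓ' , Pℓ' = unique ℓ' Pℓ' Yℓ'

  line-points : ∀ ℓ → sum (λ Y → ⟦ inc Y ℓ ⟧ * 1) ≡ suc q
  line-points ℓ = begin
    sum (λ Y → ⟦ inc Y ℓ ⟧ * 1) ≡⟨ sum-cong-≗ (λ Y → *-identityʳ ⟦ inc Y ℓ ⟧) ⟩
    sum (λ Y → ⟦ inc Y ℓ ⟧)     ≡⟨ count≡sum (λ Y → inc Y ℓ) ⟨
    count (λ Y → inc Y ℓ)       ≡⟨ lineSize ℓ ⟩
    suc q                       ∎
    where open ≡-Reasoning

  first-moment : ∀ L → sum (linesThrough L) ≡ count L * suc q
  first-moment L = begin
    sum (linesThrough L)                               ≡⟨ sum-cong-≗ (λ Y → sym (*-identityʳ (linesThrough L Y))) ⟩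
    sum (λ Y → linesThrough L Y * 1)                   ≡⟨ double-count L (λ _ → 1) ⟩
    sum (λ ℓ → ⟦ L ℓ ⟧ * sum (λ Y → ⟦ inc Y ℓ ⟧ * 1)) ≡⟨ sum-cong-≗ (λ ℓ → cong (⟦ L ℓ ⟧ *_) (line-points ℓ)) ⟩
    sum (λ ℓ → ⟦ L ℓ ⟧ * suc q)                        ≡⟨ *-distribʳ-sum (suc q) (⟦_⟧ ∘ L) ⟨
    sum (⟦_⟧ ∘ L) * suc q                              ≡⟨ cong (_* suc q) (count≡sum L) ⟨
    count L * suc q                                    ∎
    where open ≡-Reasoning

  -- Summing over the points of a line ℓ the number of lines of L through
  -- them counts every ℓ' ∈ L once, and ℓ itself q more times if ℓ ∈ L.
  lines-meeting : ∀ L ℓ → sum (λ Y → ⟦ inc Y ℓ ⟧ * linesThrough L Y) ≡ count L + q * ⟦ L ℓ ⟧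
  lines-meeting L ℓ = begin
    sum (λ Y → ⟦ inc Y ℓ ⟧ * linesThrough L Y)
      ≡⟨ sum-cong-≗ (λ Y → *-comm ⟦ inc Y ℓ ⟧ (linesThrough L Y)) ⟩
    sum (λ Y → linesThrough L Y * ⟦ inc Y ℓ ⟧)
      ≡⟨ double-count L (λ Y → ⟦ inc Y ℓ ⟧) ⟩
    sum (λ ℓ' → ⟦ L ℓ' ⟧ * sum (λ Y → ⟦ inc Y ℓ' ⟧ * ⟦ inc Y ℓ ⟧))
      ≡⟨ sum-cong-≗ (λ ℓ' → cong (⟦ L ℓ' ⟧ *_) (meet-size ℓ' ℓ)) ⟩
    sum (λ ℓ' → ⟦ L ℓ' ⟧ * (1 + q * δ ℓ' ℓ))
      ≡⟨ sum-cong-≗ (λ ℓ' → expand ⟦ L ℓ' ⟧ q (δ ℓ' ℓ)) ⟩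
    sum (λ ℓ' → ⟦ L ℓ' ⟧ + q * (⟦ L ℓ' ⟧ * δ ℓ' ℓ))
      ≡⟨ ∑-distrib-+ (⟦_⟧ ∘ L) (λ ℓ' → q * (⟦ L ℓ' ⟧ * δ ℓ' ℓ)) ⟩
    sum (⟦_⟧ ∘ L) + sum (λ ℓ' → q * (⟦ L ℓ' ⟧ * δ ℓ' ℓ))
      ≡⟨ cong₂ _+_ (count≡sum L) (*-distribˡ-sum q (λ ℓ' → ⟦ L ℓ' ⟧ * δ ℓ' ℓ)) ⟨
    count L + q * sum (λ ℓ' → ⟦ L ℓ' ⟧ * δ ℓ' ℓ)
      ≡⟨ cong (λ k → count L + q * k) (sum-δ (⟦_⟧ ∘ L) ℓ) ⟩
    count L + q * ⟦ L ℓ ⟧ ∎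
    where
    open ≡-Reasoning
    expand : ∀ u q k → u * (1 + q * k) ≡ u + q * (u * k)
    expand = solve-∀

  -- Second moment: Σ_Y #{ℓ ∈ L : Y ∈ ℓ}² = |L| (|L| + q), because two
  -- distinct lines of L meet in exactly one point.
  second-moment : ∀ L → sum (λ Y → linesThrough L Y * linesThrough L Y) ≡ count L * (count L + q)
  second-moment L = begin
    sum (λ Y → linesThrough L Y * linesThrough L Y)
      ≡⟨ double-count L (linesThrough L) ⟩
    sum (λ ℓ → ⟦ L ℓ ⟧ * sum (λ Y → ⟦ inc Y ℓ ⟧ * linesThrough L Y))
      ≡⟨ sum-cong-≗ (λ ℓ → cong (⟦ L ℓ ⟧ *_) (lines-meeting L ℓ)) ⟩
    sum (λ ℓ → ⟦ L ℓ ⟧ * (count L + q * ⟦ L ℓ ⟧))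
      ≡⟨ sum-cong-≗ (λ ℓ → on-L (L ℓ)) ⟩
    sum (λ ℓ → ⟦ L ℓ ⟧ * (count L + q))
      ≡⟨ *-distribʳ-sum (count L + q) (⟦_⟧ ∘ L) ⟨
    sum (⟦_⟧ ∘ L) * (count L + q)
      ≡⟨ cong (_* (count L + q)) (count≡sum L) ⟨
    count L * (count L + q) ∎
    where
    open ≡-Reasoning
    on-L : ∀ b → ⟦ b ⟧ * (count L + q * ⟦ b ⟧) ≡ ⟦ b ⟧ * (count L + q)
    on-L true  = cong (λ k → count L + k + 0) (*-identityʳ q)
    on-L false = refl

  -- A point P off some line g lies on q + 1 lines: the lines through P
  -- correspond to the points of g where they meet it.
  point-degree : ∀ P g → inc P g ≡ false → count (λ ℓ → inc P ℓ) ≡ suc q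
  point-degree P g Pg = begin
    count (λ ℓ → inc P ℓ)
      ≡⟨ count≡sum (λ ℓ → inc P ℓ) ⟩
    sum (λ ℓ → ⟦ inc P ℓ ⟧)
      ≡⟨ sum-cong-≗ line-meets-g ⟩
    sum (λ ℓ → ⟦ inc P ℓ ⟧ * sum (λ Y → ⟦ inc Y ℓ ⟧ * ⟦ inc Y g ⟧))
      ≡⟨ double-count (λ ℓ → inc P ℓ) (λ Y → ⟦ inc Y g ⟧) ⟨
    sum (λ Y → linesThrough (λ ℓ → inc P ℓ) Y * ⟦ inc Y g ⟧)
      ≡⟨ sum-cong-≗ point-joins-P ⟩
    sum (λ Y → ⟦ inc Y g ⟧)
      ≡⟨ count≡sum (λ Y → inc Y g) ⟨
    count (λ Y → inc Y g)
      ≡⟨ lineSize g ⟩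
    suc q ∎
    where
    open ≡-Reasoning
    line-meets-g : ∀ ℓ → ⟦ inc P ℓ ⟧ ≡ ⟦ inc P ℓ ⟧ * sum (λ Y → ⟦ inc Y ℓ ⟧ * ⟦ inc Y g ⟧)
    line-meets-g ℓ with inc P ℓ in Pℓ
    ... | false = refl
    ... | true  = cong (_+ 0) (begin
      1             ≡⟨ cong suc (*-zeroʳ q) ⟨
      1 + q * 0     ≡⟨ cong (λ k → 1 + q * k) (δ-≢ ℓ≢g) ⟨
      1 + q * δ ℓ g ≡⟨ meet-size ℓ g ⟨
      _             ∎)
      where
      ℓ≢g : ℓ ≢ g
      ℓ≢g refl with trans (sym Pℓ) Pg
      ... | ()
    point-joins-P : ∀ Y → linesThrough (λ ℓ → inc P ℓ) Y * ⟦ inc Y g ⟧ ≡ ⟦ inc Y g ⟧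
    point-joins-P Y with inc Y g in Yg
    ... | false = *-zeroʳ (linesThrough (λ ℓ → inc P ℓ) Y)
    ... | true  = cong (_* 1) (join-count P Y P≢Y)
      where
      P≢Y : P ≢ Y
      P≢Y refl with trans (sym Pg) Yg
      ... | ()

  pencil : ∀ P → count (λ ℓ → inc P ℓ) ≡ suc q →
    ∀ Y → linesThrough (λ ℓ → inc P ℓ) Y ≡ 1 + q * δ Y P
  pencil P deg Y with Y ≟ P
  ... | yes refl = trans (count-cong (λ ℓ → ∧-idem (inc P ℓ))) (trans deg (cong suc (sym (*-identityʳ q))))
  ... | no  Y≢P  = trans (join-count P Y (Y≢P ∘ sym)) (cong suc (sym (*-zeroʳ q)))

  point-off-line : Σ (Fin nPoints) λ P → Σ (Fin nLines) λ g → inc P g ≡ false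
  point-off-line with quadrangle
  ... | A , B , C , _ , _ , _ , _ , B≢C , _ , _ , ABC , _ with join B C B≢C
  ...   | g , Bg , Cg , _ = A , g , ∧-falseˡ (ABC g) (cong₂ _∧_ Bg Cg)

  -- A projective plane of order q has q² + q + 1 points: count the points
  -- on the q + 1 lines through a point P.
  point-count : nPoints ≡ q * q + q + 1
  point-count with point-off-line
  ... | P , g , Pg = +-cancelʳ-≡ q _ _ (begin
    nPoints + q
      ≡⟨ cong₂ _+_ (sum-ones nPoints) (sum-δ (λ _ → q) P) ⟨
    sum {nPoints} (λ _ → 1) + sum (λ Y → q * δ Y P)
      ≡⟨ ∑-distrib-+ (λ _ → 1) (λ Y → q * δ Y P) ⟨
    sum (λ Y → 1 + q * δ Y P)
      ≡⟨ sum-cong-≗ (pencil P deg) ⟨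
    sum (linesThrough (λ ℓ → inc P ℓ))
      ≡⟨ first-moment (λ ℓ → inc P ℓ) ⟩
    count (λ ℓ → inc P ℓ) * suc q
      ≡⟨ cong (_* suc q) deg ⟩
    suc q * suc q
      ≡⟨ square-suc q ⟩
    q * q + q + 1 + q ∎)
    where
    open ≡-Reasoning
    deg : count (λ ℓ → inc P ℓ) ≡ suc q
    deg = point-degree P g Pg
    square-suc : ∀ q → suc q * suc q ≡ q * q + q + 1 + q
    square-suc = solve-∀

  module KMArc (p : ℕ) .{{_ : NonZero p}} (m t : ℕ) (S : Fin nPoints → Bool)
               (arc : IsModPGenKMArc Π p m t S) (t≢m : t ≢ m) where
    open IsModPGenKMArc arc using (secants)

    properSecant : Fin nLines → Bool
    properSecant ℓ = ⌊ 0 <? meetSize Π S ℓ ⌋ ∧ ⌊ meetSize Π S ℓ % p ℕ.≟ t ⌋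

    properSecant-intro : ∀ ℓ → 0 < meetSize Π S ℓ → Secant Π p S t ℓ → properSecant ℓ ≡ true
    properSecant-intro ℓ meets sec with 0 <? meetSize Π S ℓ | meetSize Π S ℓ % p ℕ.≟ t
    ... | yes _       | yes _    = refl
    ... | no  ¬meets  | _        = ⊥-elim (¬meets meets)
    ... | yes _       | no  ¬sec = ⊥-elim (¬sec sec)

    properSecant-elim : ∀ ℓ → properSecant ℓ ≡ true → 0 < meetSize Π S ℓ × Secant Π p S t ℓ
    properSecant-elim ℓ _ with 0 <? meetSize Π S ℓ | meetSize Π S ℓ % p ℕ.≟ t
    properSecant-elim ℓ _  | yes meets | yes sec = meets , sec
    properSecant-elim ℓ () | yes _     | no  _
    properSecant-elim ℓ () | no  _     | _

    meetSize≡sum : ∀ ℓ → meetSize Π S ℓ ≡ sum (λ Y → ⟦ inc Y ℓ ⟧ * ⟦ S Y ⟧)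
    meetSize≡sum ℓ = trans (count≡sum (λ Y → inc Y ℓ ∧ S Y)) (sum-cong-≗ (λ Y → ⟦∧⟧ (inc Y ℓ) (S Y)))

    -- Every point of S lies on exactly one proper t_p-secant: the t_p-secant
    -- through it meets S, and all its other lines are m_p-secants, m ≠ t.
    one-secant-per-point : ∀ R → S R ≡ true → linesThrough properSecant R ≡ 1
    one-secant-per-point R SR with secants R SR
    ... | l , Rl , sec , others = count-unique _ l (cong₂ _∧_ Rl (properSecant-intro l meets sec)) only-l
      where
      meets : 0 < meetSize Π S l
      meets = count-pos (λ Y → inc Y l ∧ S Y) R (cong₂ _∧_ Rl SR)
      only-l : ∀ ℓ → (inc R ℓ ∧ properSecant ℓ) ≡ true → ℓ ≡ l
      only-l ℓ Rℓ∧proper with ∧-true Rℓ∧proper | ℓ ≟ l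
      ... | _  , _      | yes ℓ≡l = ℓ≡l
      ... | Rℓ , proper | no  ℓ≢l = ⊥-elim (t≢m (trans (sym (proj₂ (properSecant-elim ℓ proper))) (others ℓ Rℓ ℓ≢l)))

    sum-on-S : ∀ (f : Fin nPoints → ℕ) → (∀ R → S R ≡ true → f R ≡ 1) →
      sum (λ Y → ⟦ S Y ⟧ * f Y) ≡ count S
    sum-on-S f f≡1 = trans (sum-cong-≗ on-S) (sym (count≡sum S))
      where
      on-S : ∀ Y → ⟦ S Y ⟧ * f Y ≡ ⟦ S Y ⟧
      on-S Y with S Y in SY
      ... | false = refl
      ... | true  = cong (_+ 0) (f≡1 Y SY)

    -- There are at most |S| proper t_p-secants: each meets S, and each point
    -- of S is on only one of them.
    secants≤points : count properSecant ≤ count S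
    secants≤points = begin
      count properSecant
        ≡⟨ count≡sum properSecant ⟩
      sum (⟦_⟧ ∘ properSecant)
        ≤⟨ sum-mono (λ ℓ → meets-S ℓ (properSecant ℓ) (properSecant-elim ℓ)) ⟩
      sum (λ ℓ → ⟦ properSecant ℓ ⟧ * sum (λ Y → ⟦ inc Y ℓ ⟧ * ⟦ S Y ⟧))
        ≡⟨ double-count properSecant (⟦_⟧ ∘ S) ⟨
      sum (λ Y → linesThrough properSecant Y * ⟦ S Y ⟧)
        ≡⟨ sum-cong-≗ (λ Y → *-comm (linesThrough properSecant Y) ⟦ S Y ⟧) ⟩
      sum (λ Y → ⟦ S Y ⟧ * linesThrough properSecant Y)
        ≡⟨ sum-on-S (linesThrough properSecant) one-secant-per-point ⟩
      count S ∎
      where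
      open ≤-Reasoning
      meets-S : ∀ ℓ b → (b ≡ true → 0 < meetSize Π S ℓ × Secant Π p S t ℓ) →
        ⟦ b ⟧ ≤ ⟦ b ⟧ * sum (λ Y → ⟦ inc Y ℓ ⟧ * ⟦ S Y ⟧)
      meets-S ℓ false _      = z≤n
      meets-S ℓ true  proper = subst (1 ≤_) (trans (meetSize≡sum ℓ) (sym (+-identityʳ _))) (proj₁ (proper refl))

    secant-count-bound : (count properSecant ∸ 1) ^ 2 ≤ q ^ 3
    secant-count-bound = secant-bound q N s A B z A+s≡ B+s≡ z+s≡ secants≤points (cauchy-schwarz w x)
      where
      x w : Fin nPoints → ℕ
      x = linesThrough properSecant
      w Y = ⟦ not (S Y) ⟧
      N s z A B : ℕ
      N = count properSecant
      s = count S
      z = sum w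
      A = sum (λ Y → w Y * x Y)
      B = sum (λ Y → w Y * (x Y * x Y))
      A+s≡ : A + s ≡ N * suc q
      A+s≡ = trans (cong (A +_) (sym (sum-on-S x one-secant-per-point)))
                   (trans (sym (sum-split S x)) (first-moment properSecant))
      B+s≡ : B + s ≡ N * (N + q)
      B+s≡ = trans (cong (B +_) (sym (sum-on-S (λ Y → x Y * x Y) x²≡1)))
                   (trans (sym (sum-split S (λ Y → x Y * x Y))) (second-moment properSecant))
        where
        x²≡1 : ∀ R → S R ≡ true → x R * x R ≡ 1
        x²≡1 R SR = cong₂ _*_ (one-secant-per-point R SR) (one-secant-per-point R SR)
      z+s≡ : z + s ≡ q * q + q + 1
      z+s≡ = begin
        z + s                       ≡⟨ cong (_+ s) (count≡sum (not ∘ S)) ⟨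
        count (not ∘ S) + count S   ≡⟨ +-comm (count (not ∘ S)) s ⟩
        count S + count (not ∘ S)   ≡⟨ count-compl S ⟩
        nPoints                     ≡⟨ point-count ⟩
        q * q + q + 1               ∎
        where open ≡-Reasoning

-- Proposition 3.7.  The bound holds in every projective plane of order q.
proposition3p7 : (p n : ℕ) → Prime p → .{{_ : NonZero p}} → 1 ≤ n →
  (Π : ProjectivePlane (p ^ n)) →
  (m t : ℕ) → (S : Fin (ProjectivePlane.nPoints Π) → Bool) →
  IsModPGenKMArc Π p m t S → t ≢ m →
  (numProperSecants Π p S t ∸ 1) ^ 2 ≤ (p ^ n) ^ 3
proposition3p7 p n _ _ Π m t S arc t≢m = Plane.KMArc.secant-count-bound Π p m t S arc t≢m
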